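{- Let $s$ be a string and $k\ge0$ an integer. Let $uv$ and $u'v'$ be two prefixes of $s$ that both belong to $O_k$, with $|u|<|u'|$, and let $\Delta=|u'|-|u|$. Then $|u|-\Delta$ is an op-border of $u$ and also an op-border of $v$.
   Context: Strings are finite sequences over a totally ordered alphabet, indexed from $1$; $s[i..j]$ denotes a fragment. Two strings $u,v$ are order-isomorphic, written $u\approx v$, if $|u|=|v|$ and for all $i,j$ we have $u[i]\le u[j]$ iff $v[i]\le v[j]$. An order-preserving square (op-square) is a string $uv$ with $u\approx v$ and $u\ne v$. Its arms $u$ and $v$ have equal length. For a string $s$ and an integer $k\ge0$, $O_k$ denotes the set of prefixes of $s$ that are op-squares and have length in $[2^k,2^{k+1})$. An integer $b$ with $0\le b\le |x|$ is an op-border of a string $x$ if $x[1..b]\approx x[|x|-b+1..|x|]$. -}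

module Defs where

open import Level using (Level)
open import Data.Nat using (ℕ; _+_; _∸_; _<_; _≤_; _^_)
open import Data.List using (List; length; take; drop; _++_)
open import Data.Fin using (Fin)
open import Data.Product using (Σ; ∃; _×_; _,_)
open import Relation.Binary.PropositionalEquality using (_≡_; _≢_; subst)
open import Relation.Binary.Bundles using (TotalOrder)
open import Function.Bundles using (_⇔_)
import Data.List as L

module _ {c ℓ₁ ℓ₂ : Level} (A : TotalOrder c ℓ₁ ℓ₂) where
  open TotalOrder A renaming (Carrier to Σ₀; _≤_ to _≼_)

  -- order-isomorphism: equal length and same pairwise comparisons
  -- (positions indexed by Fin, 0-based; equivalent to the paper's 1-based indexing)
  record _≈ₒ_ (u v : List Σ₀) : Set (c Level.⊔ ℓ₂) where
    field
      len : length u ≡ length v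
      cmp : ∀ (i j : Fin (length u)) →
            (L.lookup u i ≼ L.lookup u j) ⇔
            (L.lookup v (subst Fin len i) ≼ L.lookup v (subst Fin len j))

  IsOpSquare : List Σ₀ → Set (c Level.⊔ ℓ₂)
  IsOpSquare x = ∃ λ u → ∃ λ v → x ≡ u ++ v × u ≈ₒ v × u ≢ v

  IsOpBorder : ℕ → List Σ₀ → Set (c Level.⊔ ℓ₂)
  IsOpBorder b x = b ≤ length x × take b x ≈ₒ drop (length x ∸ b) x

  IsPrefix : List Σ₀ → List Σ₀ → Set c
  IsPrefix p s = ∃ λ w → s ≡ p ++ w

  InOk : List Σ₀ → ℕ → List Σ₀ → List Σ₀ → Set (c Level.⊔ ℓ₂)
  InOk s k u v =
    IsPrefix (u ++ v) s × u ≈ₒ v × u ≢ v ×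
    2 ^ k ≤ length (u ++ v) × length (u ++ v) < 2 ^ (k + 1)

-- Let n = |u|, so that v = s[n .. 2n). Truncating the op-square u′v′ to arms of length n
-- gives u ≈ y for the window y = s[n+Δ .. 2n+Δ), i.e. v's window shifted right by Δ. The
-- first n − Δ letters of y are the last n − Δ letters of v, so v ≈ y makes n − Δ an
-- op-border of v, and u ≈ v carries it over to u. When Δ ≥ n the border n ∸ Δ is 0.
module Submission where

open import Defs
open import Level using (Level; _⊔_)
open import Data.Nat using (ℕ; zero; suc; _+_; _∸_; _<_; _≤_; _≤?_; _⊓_; z≤n; s≤s)
open import Data.Nat.Properties
  using (≤-refl; <⇒≤; ≰⇒>; m∸n≤m; m∸[m∸n]≡n; m+[n∸m]≡n; m≤n⇒m⊓n≡m; m≤n⇒m∸n≡0)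
open import Data.List using (List; []; _∷_; length; take; drop; _++_; lookup)
open import Data.List.Properties
  using (++-assoc; length-take; length-drop; take-take; take-[]; drop-drop; drop-all)
open import Data.Fin using (Fin; toℕ; fromℕ<)
open import Data.Fin.Properties using (toℕ-fromℕ<; toℕ-cast; subst-is-cast)
open import Data.Product using (∃; _×_; _,_; proj₁; proj₂)
open import Relation.Nullary using (yes; no)
open import Relation.Binary.PropositionalEquality
open import Relation.Binary.Bundles using (TotalOrder)
open import Function.Bundles using (_⇔_)
open import Function.Construct.Symmetry using (⇔-sym)
open import Function.Construct.Composition using (_⇔-∘_)

module ListWindows {a} {C : Set a} where

  take-length-++ : ∀ (x y : List C) → take (length x) (x ++ y) ≡ x
  take-length-++ []      y = refl
  take-length-++ (c ∷ x) y = cong (c ∷_) (take-length-++ x y)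

  drop-length-++ : ∀ (x y : List C) → drop (length x) (x ++ y) ≡ y
  drop-length-++ []      y = refl
  drop-length-++ (c ∷ x) y = drop-length-++ x y

  take-take-≤ : ∀ {m n} (x : List C) → m ≤ n → take m (take n x) ≡ take m x
  take-take-≤ {m} {n} x m≤n = trans (take-take m n x) (cong (λ k → take k x) (m≤n⇒m⊓n≡m m≤n))

  drop-take : ∀ m n (x : List C) → drop m (take n x) ≡ take (n ∸ m) (drop m x)
  drop-take zero    n       x       = refl
  drop-take (suc m) zero    x       = refl
  drop-take (suc m) (suc n) []      = sym (take-[] (n ∸ m))
  drop-take (suc m) (suc n) (c ∷ x) = drop-take m n x

  drop-window : ∀ d i l (s : List C) →
                drop d (take l (drop i s)) ≡ take (l ∸ d) (take l (drop (i + d) s))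
  drop-window d i l s = begin
    drop d (take l (drop i s))          ≡⟨ drop-take d l (drop i s) ⟩
    take (l ∸ d) (drop d (drop i s))    ≡⟨ cong (take (l ∸ d)) (drop-drop i d s) ⟩
    take (l ∸ d) (drop (i + d) s)       ≡⟨ take-take-≤ (drop (i + d) s) (m∸n≤m l d) ⟨
    take (l ∸ d) (take l (drop (i + d) s)) ∎
    where open ≡-Reasoning

  prefix-arms : ∀ {s u v : List C} → (∃ λ w → s ≡ (u ++ v) ++ w) → length u ≡ length v →
                take (length u) s ≡ u × take (length u) (drop (length u) s) ≡ v
  prefix-arms {u = u} {v} (w , refl) ∣u∣≡∣v∣ =
    trans (cong (take (length u)) (++-assoc u v w)) (take-length-++ u (v ++ w)) ,
    (begin
      take (length u) (drop (length u) ((u ++ v) ++ w))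
        ≡⟨ cong (λ z → take (length u) (drop (length u) z)) (++-assoc u v w) ⟩
      take (length u) (drop (length u) (u ++ v ++ w))
        ≡⟨ cong (take (length u)) (drop-length-++ u (v ++ w)) ⟩
      take (length u) (v ++ w)
        ≡⟨ cong (λ k → take k (v ++ w)) ∣u∣≡∣v∣ ⟩
      take (length v) (v ++ w)
        ≡⟨ take-length-++ v w ⟩
      v ∎)
    where open ≡-Reasoning

open ListWindows

module OpBorders {c ℓ₁ ℓ₂ : Level} (A : TotalOrder c ℓ₁ ℓ₂) where
  open TotalOrder A renaming (Carrier to C; _≤_ to _≼_) using ()

  infix 4 _[_]=_ _≅_

  -- ℕ-indexed positions avoid the Fin casts of _≈ₒ_; see ≈ₒ⇒≅ and ≅⇒≈ₒ.
  data _[_]=_ : List C → ℕ → C → Set c where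
    here  : ∀ {a x} → a ∷ x [ 0 ]= a
    there : ∀ {b x i a} → x [ i ]= a → b ∷ x [ suc i ]= a

  []=-deterministic : ∀ {x i a b} → x [ i ]= a → x [ i ]= b → a ≡ b
  []=-deterministic here      here      = refl
  []=-deterministic (there p) (there q) = []=-deterministic p q

  []=⇒< : ∀ {x i a} → x [ i ]= a → i < length x
  []=⇒< here      = s≤s z≤n
  []=⇒< (there p) = s≤s ([]=⇒< p)

  <⇒[]= : ∀ {x i} → i < length x → ∃ (x [ i ]=_)
  <⇒[]= {a ∷ x} {zero}  _       = a , here
  <⇒[]= {a ∷ x} {suc i} (s≤s p) with <⇒[]= p
  ... | b , q = b , there q

  lookup-[]= : ∀ x (f : Fin (length x)) → x [ toℕ f ]= lookup x f
  lookup-[]= (a ∷ x) Fin.zero    = here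
  lookup-[]= (a ∷ x) (Fin.suc f) = there (lookup-[]= x f)

  lookup-≡ : ∀ {x i a} (f : Fin (length x)) → toℕ f ≡ i → x [ i ]= a → lookup x f ≡ a
  lookup-≡ {x} f refl p = []=-deterministic (lookup-[]= x f) p

  take-[]= : ∀ m {x i a} → take m x [ i ]= a → x [ i ]= a
  take-[]= (suc m) {_ ∷ _} here      = here
  take-[]= (suc m) {_ ∷ _} (there p) = there (take-[]= m p)

  drop-[]= : ∀ m {x i a} → drop m x [ i ]= a → x [ m + i ]= a
  drop-[]= zero    p = p
  drop-[]= (suc m) {_ ∷ _} p = there (drop-[]= m p)

  record _≅_ (u v : List C) : Set (c ⊔ ℓ₂) where
    field
      len : length u ≡ length v
      cmp : ∀ {i j a a′ b b′} → u [ i ]= a → u [ j ]= a′ → v [ i ]= b → v [ j ]= b′ →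
            (a ≼ a′) ⇔ (b ≼ b′)
  open _≅_

  ≼⇔≼-cong : ∀ {a a₁ b b₁ c c₁ d d₁} → a ≡ a₁ → b ≡ b₁ → c ≡ c₁ → d ≡ d₁ →
             (a ≼ b) ⇔ (c ≼ d) → (a₁ ≼ b₁) ⇔ (c₁ ≼ d₁)
  ≼⇔≼-cong refl refl refl refl e = e

  toℕ-subst : ∀ {m n} (e : m ≡ n) (f : Fin m) → toℕ (subst Fin e f) ≡ toℕ f
  toℕ-subst e f = trans (cong toℕ (subst-is-cast e f)) (toℕ-cast e f)

  ≈ₒ⇒≅ : ∀ {u v} → _≈ₒ_ A u v → u ≅ v
  ≈ₒ⇒≅ {u} {v} o = record { len = L ; cmp = λ ua ua′ vb vb′ →
      ≼⇔≼-cong (atU ua) (atU ua′) (atV ua vb) (atV ua′ vb′)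
               (_≈ₒ_.cmp o (index ua) (index ua′)) }
    where
    L : length u ≡ length v
    L = _≈ₒ_.len o
    index : ∀ {i a} → u [ i ]= a → Fin (length u)
    index ua = fromℕ< ([]=⇒< ua)
    atU : ∀ {i a} (ua : u [ i ]= a) → lookup u (index ua) ≡ a
    atU ua = lookup-≡ (index ua) (toℕ-fromℕ< _) ua
    atV : ∀ {i a b} (ua : u [ i ]= a) → v [ i ]= b → lookup v (subst Fin L (index ua)) ≡ b
    atV ua = lookup-≡ _ (trans (toℕ-subst L _) (toℕ-fromℕ< _))

  ≅⇒≈ₒ : ∀ {u v} → u ≅ v → _≈ₒ_ A u v
  ≅⇒≈ₒ {u} {v} I = record { len = len I ; cmp = λ f g →
      cmp I (lookup-[]= u f) (lookup-[]= u g) (atV f) (atV g) }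
    where
    atV : ∀ f → v [ toℕ f ]= lookup v (subst Fin (len I) f)
    atV f = subst (v [_]= lookup v (subst Fin (len I) f)) (toℕ-subst (len I) f)
                  (lookup-[]= v (subst Fin (len I) f))

  []≅[] : [] ≅ []
  []≅[] = record { len = refl ; cmp = λ () }

  ≅-sym : ∀ {u v} → u ≅ v → v ≅ u
  ≅-sym I = record { len = sym (len I) ; cmp = λ va va′ ub ub′ → ⇔-sym (cmp I ub ub′ va va′) }

  ≅-trans : ∀ {u v w} → u ≅ v → v ≅ w → u ≅ w
  ≅-trans {u} {v} I J = record { len = trans (len I) (len J) ; cmp = λ ua ua′ wc wc′ →
      let b , vb = middle ua ; b′ , vb′ = middle ua′
      in cmp J vb vb′ wc wc′ ⇔-∘ cmp I ua ua′ vb vb′ }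
    where
    middle : ∀ {i a} → u [ i ]= a → ∃ (v [ i ]=_)
    middle ua = <⇒[]= (subst (_ <_) (len I) ([]=⇒< ua))

  ≅-take : ∀ m {u v} → u ≅ v → take m u ≅ take m v
  ≅-take m {u} {v} I = record
    { len = trans (length-take m u) (trans (cong (m ⊓_) (len I)) (sym (length-take m v)))
    ; cmp = λ ua ua′ vb vb′ → cmp I (take-[]= m ua) (take-[]= m ua′) (take-[]= m vb) (take-[]= m vb′) }

  ≅-drop : ∀ m {u v} → u ≅ v → drop m u ≅ drop m v
  ≅-drop m {u} {v} I = record
    { len = trans (length-drop m u) (trans (cong (_∸ m) (len I)) (sym (length-drop m v)))
    ; cmp = λ ua ua′ vb vb′ → cmp I (drop-[]= m ua) (drop-[]= m ua′) (drop-[]= m vb) (drop-[]= m vb′) }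

  take-op-square-prefix : ∀ m {s u v} → (∃ λ w → s ≡ (u ++ v) ++ w) → u ≅ v → m ≤ length u →
                          take m s ≅ take m (drop (length u) s)
  take-op-square-prefix m {s} {u} {v} uv≼s u≅v m≤∣u∣ = subst₂ _≅_ take-u take-v (≅-take m u≅v)
    where
    arms : take (length u) s ≡ u × take (length u) (drop (length u) s) ≡ v
    arms = prefix-arms uv≼s (len u≅v)
    take-u : take m u ≡ take m s
    take-u = trans (cong (take m) (sym (proj₁ arms))) (take-take-≤ s m≤∣u∣)
    take-v : take m v ≡ take m (drop (length u) s)
    take-v = trans (cong (take m) (sym (proj₂ arms))) (take-take-≤ (drop (length u) s) m≤∣u∣)

  zero-isOpBorder : ∀ x → IsOpBorder A 0 x
  zero-isOpBorder x = z≤n , ≅⇒≈ₒ (subst ([] ≅_) (sym (drop-all (length x) x ≤-refl)) []≅[])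

  isOpBorder-resp-≅ : ∀ {b u v} → u ≅ v → IsOpBorder A b v → IsOpBorder A b u
  isOpBorder-resp-≅ {b} {u} {v} I (b≤∣v∣ , border) =
    subst (b ≤_) (sym (len I)) b≤∣v∣ ,
    ≅⇒≈ₒ (≅-trans (≅-take b I) (≅-trans (≈ₒ⇒≅ border) (≅-sym suffixes)))
    where
    suffixes : drop (length u ∸ b) u ≅ drop (length v ∸ b) v
    suffixes = subst (λ n → drop (n ∸ b) u ≅ drop (length v ∸ b) v) (sym (len I))
                     (≅-drop (length v ∸ b) I)

  shifted-copy⇒isOpBorder : ∀ {d u v y} → d ≤ length u → u ≅ v → u ≅ y →
                            take (length u ∸ d) y ≡ drop d v → IsOpBorder A (length u ∸ d) v
  shifted-copy⇒isOpBorder {d} {u} {v} {y} d≤∣u∣ u≅v u≅y prefix≡suffix =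
    subst (b ≤_) (len u≅v) (m∸n≤m _ d) ,
    ≅⇒≈ₒ (subst (take b v ≅_) (trans prefix≡suffix (cong (λ e → drop e v) drop-count))
                (≅-take b (≅-trans (≅-sym u≅v) u≅y)))
    where
    b : ℕ
    b = length u ∸ d
    drop-count : d ≡ length v ∸ b
    drop-count = sym (trans (cong (_∸ b) (sym (len u≅v))) (m∸[m∸n]≡n d≤∣u∣))

  shifted-copy-borders : ∀ d {u v y} → u ≅ v → u ≅ y → take (length u ∸ d) y ≡ drop d v →
                         IsOpBorder A (length u ∸ d) u × IsOpBorder A (length u ∸ d) v
  shifted-copy-borders d {u} {v} u≅v u≅y prefix≡suffix with d ≤? length u
  ... | yes d≤∣u∣ = isOpBorder-resp-≅ u≅v border , border
    where
    border : IsOpBorder A (length u ∸ d) v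
    border = shifted-copy⇒isOpBorder d≤∣u∣ u≅v u≅y prefix≡suffix
  ... | no d≰∣u∣ = subst (λ b → IsOpBorder A b u) (sym b≡0) (zero-isOpBorder u) ,
                   subst (λ b → IsOpBorder A b v) (sym b≡0) (zero-isOpBorder v)
    where
    b≡0 : length u ∸ d ≡ 0
    b≡0 = m≤n⇒m∸n≡0 (<⇒≤ (≰⇒> d≰∣u∣))

proposition7 : ∀ {c ℓ₁ ℓ₂ : Level} (A : TotalOrder c ℓ₁ ℓ₂) →
    (s : List (TotalOrder.Carrier A)) (k : ℕ) →
    (u v u′ v′ : List (TotalOrder.Carrier A)) →
    InOk A s k u v → InOk A s k u′ v′ →
    length u < length u′ →
    IsOpBorder A (length u ∸ (length u′ ∸ length u)) u ×
    IsOpBorder A (length u ∸ (length u′ ∸ length u)) v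
proposition7 A s k u v u′ v′ (uv≼s , u≈v , _) (u′v′≼s , u′≈v′ , _) ∣u∣<∣u′∣ =
  shifted-copy-borders Δ (≈ₒ⇒≅ u≈v) u≅y prefix≡suffix
  where
  open OpBorders A
  open ≡-Reasoning
  n n′ Δ : ℕ
  n = length u
  n′ = length u′
  Δ = n′ ∸ n
  n≤n′ : n ≤ n′
  n≤n′ = <⇒≤ ∣u∣<∣u′∣
  u-arms : take n s ≡ u × take n (drop n s) ≡ v
  u-arms = prefix-arms uv≼s (_≈ₒ_.len u≈v)
  y : List (TotalOrder.Carrier A)
  y = take n (drop n′ s)

  u≅y : u ≅ y
  u≅y = subst (_≅ y) (proj₁ u-arms) (take-op-square-prefix n u′v′≼s (≈ₒ⇒≅ u′≈v′) n≤n′)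

  prefix≡suffix : take (n ∸ Δ) y ≡ drop Δ v
  prefix≡suffix = begin
    take (n ∸ Δ) (take n (drop n′ s))       ≡⟨ cong (λ m → take (n ∸ Δ) (take n (drop m s))) (m+[n∸m]≡n n≤n′) ⟨
    take (n ∸ Δ) (take n (drop (n + Δ) s))  ≡⟨ drop-window Δ n n s ⟨
    drop Δ (take n (drop n s))              ≡⟨ cong (drop Δ) (proj₂ u-arms) ⟩
    drop Δ v                                ∎
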